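{- Let $\mathcal{A}$ be a weighted alphabet and $\le$ an embedding order on $\mathcal{A}^*$. Let $W,V\in\mathcal{A}^*$ with $V=b_1b_2\cdots b_m$, let $X=b_1\cdots b_i$ be a prefix of $V$ and $Y=b_{i+1}\cdots b_m$ the corresponding suffix. Let $P$ be the longest prefix of $W$ such that $P\le X$, and write $W=PS$. Then $W\le V$ if and only if $S\le Y$.
   Context: $\mathcal{A}$ is a set of letters, each with a positive integer weight $\mathrm{wt}(a)$; $\mathcal{A}^*$ is the set of finite words over $\mathcal{A}$ (including the empty word $\epsilon$), with concatenation as product, and $\mathrm{wt}(a_1\cdots a_k)=\sum_i\mathrm{wt}(a_i)$. An embedding order is a partial order $\le$ on $\mathcal{A}^*$ such that: (i) $\epsilon\le W$ for every $W$; (ii) if $W\le V$ and $W\ne V$ then $\mathrm{wt}(W)<\mathrm{wt}(V)$; (iii) if $V=a_1a_2\cdots a_k$ with $a_i\in\mathcal{A}$, then for any $W\in\mathcal{A}^*$, $W\le V$ if and only if $W$ has a factorisation $W=W_1W_2\cdots W_k$ (with $W_i\in\mathcal{A}^*$, possibly empty) such that $W_i\le a_i$ for each $i$. -}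

module Defs where

open import Data.Nat using (ℕ; _<_)
open import Data.List using (List; []; _∷_; [_]; _++_; map; concat)
open import Data.Nat.ListAction using (sum)
open import Data.List.Relation.Binary.Pointwise using (Pointwise)
open import Data.Product using (Σ; ∃; _×_)
open import Relation.Binary.Core using (Rel)
open import Relation.Binary.Structures using (IsPartialOrder)
open import Relation.Binary.PropositionalEquality using (_≡_)
open import Function.Bundles using (_⇔_)
open import Relation.Nullary using (¬_)
open import Level using (0ℓ)

record WeightedAlphabet (A : Set) : Set where
  field
    wt      : A → ℕ
    wt-pos  : ∀ a → 0 < wt a

wtW : {A : Set} → (A → ℕ) → List A → ℕ
wtW wt W = sum (map wt W)

Factorises : {A : Set} → Rel (List A) 0ℓ → List A → List A → Set
Factorises {A} _≤_ W V =
  Σ (List (List A)) λ Ws → concat Ws ≡ W × Pointwise (λ Wi a → Wi ≤ [ a ]) Ws V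

record IsEmbeddingOrder {A : Set} (wt : A → ℕ) (_≤_ : Rel (List A) 0ℓ) : Set where
  field
    isPartialOrder : IsPartialOrder _≡_ _≤_
    ε-least        : ∀ W → [] ≤ W
    strict-wt      : ∀ {W V} → W ≤ V → ¬ (W ≡ V) → wtW wt W < wtW wt V
    factor         : ∀ W V → (W ≤ V) ⇔ Factorises _≤_ W V

module Submission where

-- Axiom (iii) of an embedding order says that W ⊑ V holds
-- exactly when W factorises letter by letter along V.  Cutting such a
-- letter-wise factorisation at the boundary of V = X ++ Y gives
--
--   W ⊑ X ++ Y   iff   W = W₁ ++ W₂ for some W₁ ⊑ X and W₂ ⊑ Y,
--
-- i.e. ⊑ is compatible with concatenation (`⊑-++-split`, `⊑-++-join`).
-- A consequence is that every suffix of a word lies below the word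
-- (`suffix-⊑`).  If W ⊑ X ++ Y, split W = W₁ ++ W₂ as above; maximality of
-- P makes W₁ a prefix of P, so W₂ = T ++ S for some T (`longer-prefix`),
-- whence S ⊑ T ++ S = W₂ ⊑ Y.  Conversely S ⊑ Y and P ⊑ X give
-- P ++ S ⊑ X ++ Y by `⊑-++-join`.

open import Defs
open import Data.Nat using (ℕ; _≤_; s≤s)
open import Data.List using (List; []; _∷_; _++_; length; concat)
open import Data.List.Properties using (concat-++; ∷-injective)
open import Data.List.Relation.Binary.Pointwise as Pointwise using (Pointwise; []; _∷_)
open import Data.Product using (Σ; _×_; _,_)
open import Relation.Binary.Core using (Rel)
open import Relation.Binary.PropositionalEquality using (_≡_; refl; sym; trans)
open import Relation.Binary.Structures using (IsPartialOrder)
open import Function.Bundles using (_⇔_; mk⇔; Equivalence)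
open import Level using (0ℓ)

Pointwise-++-split : {A B : Set} {R : A → B → Set} (Ws : List A) (X Y : List B) →
  Pointwise R Ws (X ++ Y) →
  Σ (List A) λ Ws₁ → Σ (List A) λ Ws₂ →
    (Ws ≡ Ws₁ ++ Ws₂) × Pointwise R Ws₁ X × Pointwise R Ws₂ Y
Pointwise-++-split Ws [] Y rs = [] , Ws , refl , [] , rs
Pointwise-++-split (w ∷ Ws) (x ∷ X) Y (r ∷ rs)
  with Pointwise-++-split Ws X Y rs
... | Ws₁ , Ws₂ , refl , rs₁ , rs₂ = w ∷ Ws₁ , Ws₂ , refl , r ∷ rs₁ , rs₂

longer-prefix : {A : Set} (W₁ W₂ P S : List A) → W₁ ++ W₂ ≡ P ++ S →
  length W₁ ≤ length P → Σ (List A) λ T → (P ≡ W₁ ++ T) × (W₂ ≡ T ++ S)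
longer-prefix [] W₂ P S eq _ = P , refl , eq
longer-prefix (a ∷ W₁) W₂ (b ∷ P) S eq (s≤s len) with ∷-injective eq
... | refl , eq′ with longer-prefix W₁ W₂ P S eq′ len
... | T , refl , W₂≡TS = T , refl , W₂≡TS

module EmbeddingOrder {A : Set} {wt : A → ℕ} {_⊑_ : Rel (List A) 0ℓ}
                      (E : IsEmbeddingOrder wt _⊑_) where
  open IsEmbeddingOrder E
  open IsPartialOrder isPartialOrder public
    using () renaming (refl to ⊑-refl; trans to ⊑-trans)

  factorise : ∀ {W V} → W ⊑ V → Factorises _⊑_ W V
  factorise {W} {V} = Equivalence.to (factor W V)

  unfactorise : ∀ {W V} → Factorises _⊑_ W V → W ⊑ V
  unfactorise {W} {V} = Equivalence.from (factor W V)

  ⊑-++-split : ∀ W X Y → W ⊑ (X ++ Y) →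
    Σ (List A) λ W₁ → Σ (List A) λ W₂ → (W ≡ W₁ ++ W₂) × (W₁ ⊑ X) × (W₂ ⊑ Y)
  ⊑-++-split W X Y W⊑XY with factorise W⊑XY
  ... | Ws , concatWs≡W , rs with Pointwise-++-split Ws X Y rs
  ... | Ws₁ , Ws₂ , refl , rs₁ , rs₂ =
    concat Ws₁ , concat Ws₂ , trans (sym concatWs≡W) (sym (concat-++ Ws₁ Ws₂)) ,
    unfactorise (Ws₁ , refl , rs₁) , unfactorise (Ws₂ , refl , rs₂)

  ⊑-++-join : ∀ {W₁ W₂ X Y} → W₁ ⊑ X → W₂ ⊑ Y → (W₁ ++ W₂) ⊑ (X ++ Y)
  ⊑-++-join W₁⊑X W₂⊑Y with factorise W₁⊑X | factorise W₂⊑Y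
  ... | Ws₁ , refl , rs₁ | Ws₂ , refl , rs₂ =
    unfactorise (Ws₁ ++ Ws₂ , sym (concat-++ Ws₁ Ws₂) , Pointwise.++⁺ rs₁ rs₂)

  suffix-⊑ : ∀ T S → S ⊑ (T ++ S)
  suffix-⊑ T S = ⊑-++-join (ε-least T) ⊑-refl

proposition3p1 : {A : Set} (𝒜 : WeightedAlphabet A) (_⊑_ : Rel (List A) 0ℓ) →
    IsEmbeddingOrder (WeightedAlphabet.wt 𝒜) _⊑_ →
    (W X Y P S : List A) →
    W ≡ P ++ S → P ⊑ X →
    (∀ P′ S′ → W ≡ P′ ++ S′ → P′ ⊑ X → length P′ ≤ length P) →
    (W ⊑ (X ++ Y)) ⇔ (S ⊑ Y)
proposition3p1 𝒜 _⊑_ E W X Y P S refl P⊑X maximal = mk⇔ forward backward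
  where
  open EmbeddingOrder E

  -- Split W along X ++ Y; maximality of P puts S at the end of the Y-part.
  forward : W ⊑ (X ++ Y) → S ⊑ Y
  forward W⊑XY with ⊑-++-split W X Y W⊑XY
  ... | W₁ , W₂ , W≡W₁W₂ , W₁⊑X , W₂⊑Y
    with longer-prefix W₁ W₂ P S (sym W≡W₁W₂) (maximal W₁ W₂ W≡W₁W₂ W₁⊑X)
  ... | T , _ , refl = ⊑-trans (suffix-⊑ T S) W₂⊑Y

  backward : S ⊑ Y → W ⊑ (X ++ Y)
  backward = ⊑-++-join P⊑X
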